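{- Let $\overrightarrow{F}$ be an oriented graph whose compressibility $z(\overrightarrow{F})$ exists. If every tournament on $z(\overrightarrow{F})$ vertices contains $\overrightarrow{F}$ as a subgraph, then for every $n$, $\mathrm{ex}_{\mathrm{ori}}(n,\overrightarrow{F})=|E(T(n,z(\overrightarrow{F})-1))|$.
   Context: An oriented graph is a directed graph with no loops, no multiple arcs and no pair of opposite arcs. $\mathrm{ex}_{\mathrm{ori}}(n,\overrightarrow{F})$ is the largest number of arcs in an $n$-vertex oriented graph not containing $\overrightarrow{F}$ as a (not necessarily induced) subgraph. A homomorphism from a digraph $H$ to a digraph $D$ is a map $f:V(H)\to V(D)$ with $f(u)f(v)\in E(D)$ whenever $uv\in E(H)$. The compressibility $z(\overrightarrow{F})$ is the smallest $k$ such that there is a homomorphism from $\overrightarrow{F}$ to every tournament on $k$ vertices (such $k$ exists exactly when $\overrightarrow{F}$ has no directed cycle). $T(n,k)$ denotes the Turán graph, the complete $k$-partite graph on $n$ vertices with part sizes as equal as possible. -}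

module Defs where

open import Data.Bool using (Bool; true; false; if_then_else_)
open import Data.Nat using (ℕ; zero; suc; _<_; _≤_; _∸_)
open import Data.Nat.DivMod using (_%_)
open import Data.Fin using (Fin; toℕ)
open import Data.List using (List; map; allFin)
open import Data.Nat.ListAction using (sum)
open import Data.Product using (Σ; _×_; ∃-syntax)
open import Data.Empty using (⊥)
open import Relation.Nullary using (¬_; does)
open import Relation.Binary.PropositionalEquality using (_≡_; _≢_)
open import Function.Definitions using (Injective)
open import Data.Nat using (_≟_; _<?_)
open import Data.Bool using (_∧_; not)

-- A digraph on vertex set Fin n, given by its arc relation (as a Boolean
-- adjacency matrix): there is an arc u → v iff  D u v ≡ true.
-- (This representation automatically excludes multiple arcs.)
Digraph : ℕ → Set
Digraph n = Fin n → Fin n → Bool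

Arc : ∀ {n} → Digraph n → Fin n → Fin n → Set
Arc D u v = D u v ≡ true

IsOriented : ∀ {n} → Digraph n → Set
IsOriented {n} D =
  (∀ (u : Fin n) → ¬ Arc D u u) × (∀ (u v : Fin n) → Arc D u v → ¬ Arc D v u)

IsTournament : ∀ {n} → Digraph n → Set
IsTournament {n} D =
  IsOriented D × (∀ (u v : Fin n) → u ≢ v → (Arc D u v Data.Sum.⊎ Arc D v u))
  where import Data.Sum

IsHom : ∀ {m n} → Digraph m → Digraph n → (Fin m → Fin n) → Set
IsHom {m} H D f = ∀ (u v : Fin m) → Arc H u v → Arc D (f u) (f v)

HomExists : ∀ {m n} → Digraph m → Digraph n → Set
HomExists {m} {n} H D = ∃[ f ] IsHom H D f

Contains : ∀ {m n} → Digraph n → Digraph m → Set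
Contains {m} {n} D H = ∃[ f ] (Injective _≡_ _≡_ f × IsHom H D f)

IsCompressibility : ∀ {m} → Digraph m → ℕ → Set
IsCompressibility F z =
  (∀ (T : Digraph z) → IsTournament T → HomExists F T)
  × (∀ k → k < z → ∃[ T ] (IsTournament {k} T × ¬ HomExists F T))

arcCount : ∀ {n} → Digraph n → ℕ
arcCount {n} D =
  sum (map (λ u → sum (map (λ v → if D u v then 1 else 0) (allFin n))) (allFin n))

IsFreeOriented : ∀ {m n} → Digraph m → Digraph n → Set
IsFreeOriented F D = IsOriented D × ¬ Contains D F

ExOri : ∀ {m} → Digraph m → ℕ → ℕ → Set
ExOri F n t =
  (∃[ D ] (IsFreeOriented {n = n} F D × arcCount D ≡ t))
  × (∀ (D : Digraph n) → IsFreeOriented F D → arcCount D ≤ t)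

-- Turán graph T(n,k) (k ≥ 1) on vertex set Fin n: vertex i lies in part
-- (toℕ i mod k); this yields k parts of sizes as equal as possible.
-- Edge i j (undirected) iff i, j in different parts.
turanAdj : ℕ → ∀ {n} → Fin n → Fin n → Bool
turanAdj zero i j = false                      -- unused (k = 0)
turanAdj (suc k) i j = not (does (toℕ i % suc k ≟ toℕ j % suc k))

turanEdges : ℕ → ℕ → ℕ
turanEdges n k =
  sum (map (λ i → sum (map (λ j → if does (toℕ i <? toℕ j) ∧ turanAdj k i j then 1 else 0)
                             (allFin n))) (allFin n))

-- Lower bound: take a tournament T on z − 1 vertices receiving no homomorphism from F
-- and blow it up, replacing its vertices by the classes of the Turán graph T(n, z − 1).
-- The result is an oriented graph whose underlying graph is T(n, z − 1), and a copy of
-- F in it composes with the projection to a homomorphism F → T.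
-- Upper bound: in an F-free oriented graph D, a clique on z vertices of the underlying
-- graph would span a tournament, hence a copy of F.  So the underlying graph, whose
-- edges are the arcs of D, is K_z-free, and Turán's theorem applies.  Turán's theorem
-- is proved by the classical induction: remove a clique on z − 1 vertices from a
-- K_z-free graph; every other vertex has at most z − 2 neighbours in it, and this
-- count matches the recursion for the edge numbers of Turán graphs.  The cases z ≤ 1
-- are void, since F has two vertices.

module Submission where

open import Defs
open import Data.Bool using (Bool; true; false; if_then_else_; not; _∧_; _∨_)
import Data.Bool.Properties as Bool
open import Data.Nat using (ℕ; zero; suc; _+_; _*_; _∸_; _≤_; _<_; z≤n; s≤s; _/_; _%_; _≟_; _<?_)
open import Data.Nat.Properties
open import Data.Nat.Divisibility using (∣-refl)
open import Data.Nat.DivMod using (m%n<n; m%n≤m; m<n⇒m%n≡m; %-remove-+ˡ; m≡m%n+[m/n]*n; /-monoʳ-≤)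
open import Data.Nat.Induction using (<-wellFounded)
open import Data.Fin using (Fin; zero; suc; toℕ; fromℕ<)
import Data.Fin.Properties as Fin
import Data.List as List using (map; allFin; tabulate)
import Data.List.Properties as List using (map-tabulate)
import Data.Nat.ListAction as List using (sum)
open import Data.Product using (_×_; _,_; proj₁; proj₂; ∃-syntax)
open import Data.Sum using (_⊎_; inj₁; inj₂)
open import Function using (_∘_)
open import Function.Bundles using (_⇔_; mk⇔)
open import Function.Definitions using (Injective)
open import Induction.WellFounded using (Acc; acc)
open import Relation.Binary.Definitions using (tri<; tri≈; tri>)
open import Relation.Binary.PropositionalEquality
open import Relation.Nullary using (¬_; Dec; does; yes; no; contradiction)
open import Relation.Nullary.Decidable using (dec-true; dec-false; does-⇔; map′; _×-dec_)
open import Algebra.Properties.CommutativeSemigroup +-commutativeSemigroup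
  using () renaming (x∙yz≈y∙xz to x+[y+z]≡y+[x+z])
open import Algebra.Properties.CommutativeSemigroup *-commutativeSemigroup
  using () renaming (x∙yz≈y∙xz to x*[y*z]≡y*[x*z])
open import Algebra.Properties.Semiring.Sum +-*-semiring
  using (sum; sum-syntax; sum-cong-≗; sum-replicate-zero; ∑-distrib-+; ∑-comm; *-distribˡ-sum; *-distribʳ-sum)

⟦_⟧ : Bool → ℕ
⟦ b ⟧ = if b then 1 else 0

⟦⟧≤1 : ∀ b → ⟦ b ⟧ ≤ 1
⟦⟧≤1 true = ≤-refl
⟦⟧≤1 false = z≤n

⟦not⟧+⟦⟧≡1 : ∀ b → ⟦ not b ⟧ + ⟦ b ⟧ ≡ 1
⟦not⟧+⟦⟧≡1 true = refl
⟦not⟧+⟦⟧≡1 false = refl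

_==_ : ∀ {n} → Fin n → Fin n → Bool
i == j = does (i Fin.≟ j)

does-≟-toℕ : ∀ {n} (i j : Fin n) → does (toℕ i ≟ toℕ j) ≡ i == j
does-≟-toℕ i j = does-⇔ (mk⇔ Fin.toℕ-injective (cong toℕ)) (toℕ i ≟ toℕ j) (i Fin.≟ j)

∧≡true⇒ : ∀ {a b} → a ∧ b ≡ true → a ≡ true × b ≡ true
∧≡true⇒ {true} b≡true = refl , b≡true

∨≡true⇒ : ∀ {a b} → a ∨ b ≡ true → a ≡ true ⊎ b ≡ true
∨≡true⇒ {true} _ = inj₁ refl
∨≡true⇒ {false} b≡true = inj₂ b≡true

⇒∨≡true : ∀ {a b} → a ≡ true ⊎ b ≡ true → a ∨ b ≡ true
⇒∨≡true (inj₁ refl) = refl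
⇒∨≡true {a} (inj₂ refl) = Bool.∨-zeroʳ a

x+x≡2*x : ∀ x → x + x ≡ 2 * x
x+x≡2*x x = cong (x +_) (sym (+-identityʳ x))

halve-≤ : ∀ {a b} → a + a ≤ b + b → a ≤ b
halve-≤ {a} {b} = *-cancelˡ-≤ 2 ∘ subst₂ _≤_ (x+x≡2*x a) (x+x≡2*x b)

halve-≡ : ∀ {a b} → a + a ≡ b + b → a ≡ b
halve-≡ {a} {b} = *-cancelˡ-≡ a b 2 ∘ subst₂ _≡_ (x+x≡2*x a) (x+x≡2*x b)

-- Finite sums

-- sum-cong-≗ is stated with _Preserves_⟶_, under which Agda cannot infer the summands.
∑-cong : ∀ {n} {f g : Fin n → ℕ} → (∀ i → f i ≡ g i) → sum f ≡ sum g
∑-cong = sum-cong-≗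

∑∑-cong : ∀ {m n} {f g : Fin m → Fin n → ℕ} → (∀ i j → f i j ≡ g i j) →
  ∑[ i < m ] ∑[ j < n ] f i j ≡ ∑[ i < m ] ∑[ j < n ] g i j
∑∑-cong f≡g = ∑-cong λ i → ∑-cong (f≡g i)

∑-const : ∀ n c → ∑[ i < n ] c ≡ n * c
∑-const zero c = refl
∑-const (suc n) c = cong (c +_) (∑-const n c)

∑-mono-≤ : ∀ {n} {f g : Fin n → ℕ} → (∀ i → f i ≤ g i) → sum f ≤ sum g
∑-mono-≤ {zero} f≤g = z≤n
∑-mono-≤ {suc n} f≤g = +-mono-≤ (f≤g zero) (∑-mono-≤ (f≤g ∘ suc))

∑-indicator : ∀ {n} (i : Fin n) (f : Fin n → ℕ) → ∑[ j < n ] (⟦ i == j ⟧ * f j) ≡ f i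
∑-indicator {suc n} zero f =
  trans (cong₂ _+_ (+-identityʳ (f zero)) (sum-replicate-zero n)) (+-identityʳ (f zero))
∑-indicator (suc i) f = ∑-indicator i (f ∘ suc)

∑-indicator-1 : ∀ {n} (i : Fin n) → ∑[ j < n ] ⟦ i == j ⟧ ≡ 1
∑-indicator-1 i = trans (∑-cong λ j → sym (*-identityʳ ⟦ i == j ⟧)) (∑-indicator i (λ _ → 1))

∑-indicator-not : ∀ {k} (i : Fin (suc k)) → ∑[ j < suc k ] ⟦ not (i == j) ⟧ ≡ k
∑-indicator-not {k} i = +-cancelʳ-≡ 1 _ _ (begin
  ∑[ j < suc k ] ⟦ not (i == j) ⟧ + 1
    ≡⟨ cong (∑[ j < suc k ] ⟦ not (i == j) ⟧ +_) (sym (∑-indicator-1 i)) ⟩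
  ∑[ j < suc k ] ⟦ not (i == j) ⟧ + ∑[ j < suc k ] ⟦ i == j ⟧
    ≡⟨ sym (∑-distrib-+ (λ j → ⟦ not (i == j) ⟧) (λ j → ⟦ i == j ⟧)) ⟩
  ∑[ j < suc k ] (⟦ not (i == j) ⟧ + ⟦ i == j ⟧)
    ≡⟨ trans (∑-cong λ j → ⟦not⟧+⟦⟧≡1 (i == j)) (trans (∑-const (suc k) 1) (*-identityʳ _)) ⟩
  suc k
    ≡⟨ +-comm 1 k ⟩
  k + 1 ∎)
  where open ≡-Reasoning

∑-toℕ-+ : ∀ a b (f : ℕ → ℕ) →
  ∑[ i < a + b ] f (toℕ i) ≡ ∑[ i < a ] f (toℕ i) + ∑[ i < b ] f (a + toℕ i)
∑-toℕ-+ zero b f = refl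
∑-toℕ-+ (suc a) b f =
  trans (cong (f 0 +_) (∑-toℕ-+ a b (f ∘ suc))) (sym (+-assoc (f 0) _ _))

∑-toℕ-last : ∀ p (f : ℕ → ℕ) → ∑[ i < suc p ] f (toℕ i) ≡ ∑[ i < p ] f (toℕ i) + f p
∑-toℕ-last zero f = +-comm (f 0) 0
∑-toℕ-last (suc p) f =
  trans (cong (f 0 +_) (∑-toℕ-last p (f ∘ suc))) (sym (+-assoc (f 0) _ _))

∑∑-symmetrise : ∀ {n} (g w : Fin n → Fin n → ℕ) → (∀ x y → g x y + g y x ≡ w x y) →
  ∑[ x < n ] ∑[ y < n ] g x y + ∑[ x < n ] ∑[ y < n ] g x y ≡ ∑[ x < n ] ∑[ y < n ] w x y
∑∑-symmetrise {n} g w g+gᵀ≡w = begin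
  ∑[ x < n ] ∑[ y < n ] g x y + ∑[ x < n ] ∑[ y < n ] g x y
    ≡⟨ cong (∑[ x < n ] ∑[ y < n ] g x y +_) (∑-comm g) ⟩
  ∑[ x < n ] ∑[ y < n ] g x y + ∑[ x < n ] ∑[ y < n ] g y x
    ≡⟨ sym (∑-distrib-+ (λ x → ∑[ y < n ] g x y) (λ x → ∑[ y < n ] g y x)) ⟩
  ∑[ x < n ] (∑[ y < n ] g x y + ∑[ y < n ] g y x)
    ≡⟨ ∑-cong (λ x → sym (∑-distrib-+ (g x) (λ y → g y x))) ⟩
  ∑[ x < n ] ∑[ y < n ] (g x y + g y x)
    ≡⟨ ∑∑-cong g+gᵀ≡w ⟩
  ∑[ x < n ] ∑[ y < n ] w x y ∎
  where open ≡-Reasoning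

∑∑-toℕ-+ : ∀ a b (f : ℕ → ℕ → ℕ) →
  ∑[ i < a + b ] ∑[ j < a + b ] f (toℕ i) (toℕ j)
  ≡ (∑[ i < a ] ∑[ j < a ] f (toℕ i) (toℕ j) + ∑[ i < a ] ∑[ j < b ] f (toℕ i) (a + toℕ j))
  + (∑[ i < b ] ∑[ j < a ] f (a + toℕ i) (toℕ j) + ∑[ i < b ] ∑[ j < b ] f (a + toℕ i) (a + toℕ j))
∑∑-toℕ-+ a b f = begin
  ∑[ i < a + b ] row (toℕ i)
    ≡⟨ ∑-toℕ-+ a b row ⟩
  ∑[ i < a ] row (toℕ i) + ∑[ i < b ] row (a + toℕ i)
    ≡⟨ cong₂ _+_ (∑-cong λ (i : Fin a) → ∑-toℕ-+ a b (f (toℕ i)))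
                 (∑-cong λ (i : Fin b) → ∑-toℕ-+ a b (f (a + toℕ i))) ⟩
  ∑[ i < a ] (left (toℕ i) + right (toℕ i)) + ∑[ i < b ] (left (a + toℕ i) + right (a + toℕ i))
    ≡⟨ cong₂ _+_ (∑-distrib-+ {a} (left ∘ toℕ) (right ∘ toℕ))
                 (∑-distrib-+ {b} (λ i → left (a + toℕ i)) (λ i → right (a + toℕ i))) ⟩
  _ ∎
  where
  open ≡-Reasoning
  row left right : ℕ → ℕ
  row x = ∑[ j < a + b ] f x (toℕ j)
  left x = ∑[ j < a ] f x (toℕ j)
  right x = ∑[ j < b ] f x (a + toℕ j)

sum-map-allFin : ∀ n (f : Fin n → ℕ) → List.sum (List.map f (List.allFin n)) ≡ ∑[ i < n ] f i
sum-map-allFin n f = trans (cong List.sum (List.map-tabulate (λ i → i) f)) (sum-tabulate n f)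
  where
  sum-tabulate : ∀ n (f : Fin n → ℕ) → List.sum (List.tabulate f) ≡ ∑[ i < n ] f i
  sum-tabulate zero f = refl
  sum-tabulate (suc n) f = cong (f zero +_) (sum-tabulate n (f ∘ suc))

arcCount≡∑∑ : ∀ {n} (D : Digraph n) → arcCount D ≡ ∑[ x < n ] ∑[ y < n ] ⟦ D x y ⟧
arcCount≡∑∑ {n} D = trans (sum-map-allFin n _) (∑-cong λ x → sum-map-allFin n (λ y → ⟦ D x y ⟧))

-- Turán graphs

≟-residue : ∀ {k x} (x<k+1 : x < suc k) (j : Fin (suc k)) → does (x ≟ toℕ j % suc k) ≡ fromℕ< x<k+1 == j
≟-residue x<k+1 j = trans
  (cong₂ (λ a b → does (a ≟ b)) (sym (Fin.toℕ-fromℕ< x<k+1)) (m<n⇒m%n≡m (Fin.toℕ<n j)))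
  (does-≟-toℕ (fromℕ< x<k+1) j)

-- As in turanAdj, the degenerate T(n, 0) is edgeless.
apart : ℕ → ℕ → ℕ → Bool
apart zero a b = false
apart (suc k) a b = not (does (a % suc k ≟ b % suc k))

turanAdj≡apart : ∀ K {n} (i j : Fin n) → turanAdj K i j ≡ apart K (toℕ i) (toℕ j)
turanAdj≡apart zero i j = refl
turanAdj≡apart (suc k) i j = refl

apart-sym : ∀ K a b → apart K a b ≡ apart K b a
apart-sym zero a b = refl
apart-sym (suc k) a b = cong not (does-⇔ (mk⇔ sym sym) (a % suc k ≟ b % suc k) (b % suc k ≟ a % suc k))

apart-irrefl : ∀ K a → apart K a a ≡ false
apart-irrefl zero a = refl
apart-irrefl (suc k) a = cong not (dec-true (a % suc k ≟ a % suc k) refl)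

apart-+ˡ : ∀ k a b → apart (suc k) (suc k + a) b ≡ apart (suc k) a b
apart-+ˡ k a b = cong (λ r → not (does (r ≟ b % suc k)))
  (%-remove-+ˡ a ∣-refl)

turanDegreeSum : ℕ → ℕ → ℕ
turanDegreeSum K n = ∑[ i < n ] ∑[ j < n ] ⟦ apart K (toℕ i) (toℕ j) ⟧

∑-apart-row : ∀ k a → ∑[ j < suc k ] ⟦ apart (suc k) a (toℕ j) ⟧ ≡ k
∑-apart-row k a = trans (∑-cong λ j → cong (λ b → ⟦ not b ⟧) (≟-residue (m%n<n a (suc k)) j))
                        (∑-indicator-not (fromℕ< (m%n<n a (suc k))))

∑-apart-column : ∀ k b → ∑[ i < suc k ] ⟦ apart (suc k) (toℕ i) b ⟧ ≡ k
∑-apart-column k b =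
  trans (∑-cong λ (i : Fin (suc k)) → cong ⟦_⟧ (apart-sym (suc k) (toℕ i) b)) (∑-apart-row k b)

turanDegreeSum-peel : ∀ k q → turanDegreeSum (suc k) (suc k + q)
                            ≡ (suc k * k + q * k) + (q * k + turanDegreeSum (suc k) q)
turanDegreeSum-peel k q =
  trans (∑∑-toℕ-+ K q f) (cong₂ _+_ (cong₂ _+_ clique clique-rest) (cong₂ _+_ rest-clique rest))
  where
  K = suc k
  f : ℕ → ℕ → ℕ
  f a b = ⟦ apart K a b ⟧
  apart-+ʳ : ∀ a b → f a (K + b) ≡ f a b
  apart-+ʳ a b = cong ⟦_⟧ (trans (apart-sym K a (K + b)) (trans (apart-+ˡ k b a) (apart-sym K b a)))
  clique : ∑[ i < K ] ∑[ j < K ] f (toℕ i) (toℕ j) ≡ K * k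
  clique = trans (∑-cong λ (i : Fin K) → ∑-apart-row k (toℕ i)) (∑-const K k)
  clique-rest : ∑[ i < K ] ∑[ j < q ] f (toℕ i) (K + toℕ j) ≡ q * k
  clique-rest = begin
    ∑[ i < K ] ∑[ j < q ] f (toℕ i) (K + toℕ j)
      ≡⟨ ∑-comm {K} {q} (λ i j → f (toℕ i) (K + toℕ j)) ⟩
    ∑[ j < q ] ∑[ i < K ] f (toℕ i) (K + toℕ j)
      ≡⟨ ∑∑-cong (λ (j : Fin q) (i : Fin K) → apart-+ʳ (toℕ i) (toℕ j)) ⟩
    ∑[ j < q ] ∑[ i < K ] f (toℕ i) (toℕ j)
      ≡⟨ ∑-cong (λ (j : Fin q) → ∑-apart-column k (toℕ j)) ⟩
    ∑[ j < q ] k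
      ≡⟨ ∑-const q k ⟩
    q * k ∎
    where open ≡-Reasoning
  rest-clique : ∑[ i < q ] ∑[ j < K ] f (K + toℕ i) (toℕ j) ≡ q * k
  rest-clique = trans
    (∑-cong λ (i : Fin q) →
       trans (∑-cong λ (j : Fin K) → cong ⟦_⟧ (apart-+ˡ k (toℕ i) (toℕ j))) (∑-apart-row k (toℕ i)))
    (∑-const q k)
  rest : ∑[ i < q ] ∑[ j < q ] f (K + toℕ i) (K + toℕ j) ≡ turanDegreeSum K q
  rest = ∑∑-cong λ (i j : Fin q) →
    trans (cong ⟦_⟧ (apart-+ˡ k (toℕ i) (K + toℕ j))) (apart-+ʳ (toℕ i) (toℕ j))

lastDegree : ℕ → ℕ → ℕ
lastDegree K p = ∑[ i < p ] ⟦ apart K (toℕ i) p ⟧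

turanDegreeSum-suc : ∀ K p → turanDegreeSum K (suc p) ≡ turanDegreeSum K p + (lastDegree K p + lastDegree K p)
turanDegreeSum-suc K p = begin
  ∑[ i < suc p ] row (toℕ i)
    ≡⟨ ∑-toℕ-last p row ⟩
  ∑[ i < p ] row (toℕ i) + row p
    ≡⟨ cong₂ _+_ (∑-cong λ (i : Fin p) → ∑-toℕ-last p (f (toℕ i))) (∑-toℕ-last p (f p)) ⟩
  ∑[ i < p ] (∑[ j < p ] f (toℕ i) (toℕ j) + f (toℕ i) p) + (∑[ j < p ] f p (toℕ j) + f p p)
    ≡⟨ cong₂ _+_ (∑-distrib-+ {p} (λ i → ∑[ j < p ] f (toℕ i) (toℕ j)) (λ i → f (toℕ i) p))
                 (cong₂ _+_ (∑-cong λ (j : Fin p) → cong ⟦_⟧ (apart-sym K p (toℕ j)))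
                            (cong ⟦_⟧ (apart-irrefl K p))) ⟩
  (turanDegreeSum K p + lastDegree K p) + (lastDegree K p + 0)
    ≡⟨ cong (turanDegreeSum K p + lastDegree K p +_) (+-identityʳ (lastDegree K p)) ⟩
  (turanDegreeSum K p + lastDegree K p) + lastDegree K p
    ≡⟨ +-assoc (turanDegreeSum K p) _ _ ⟩
  turanDegreeSum K p + (lastDegree K p + lastDegree K p) ∎
  where
  open ≡-Reasoning
  f : ℕ → ℕ → ℕ
  f a b = ⟦ apart K a b ⟧
  row : ℕ → ℕ
  row a = ∑[ j < suc p ] f a (toℕ j)

classSize : ℕ → ℕ → ℕ → ℕ
classSize k p c = ∑[ i < p ] ⟦ does (c ≟ toℕ i % suc k) ⟧

lastDegree+classSize : ∀ k p → lastDegree (suc k) p + classSize k p (p % suc k) ≡ p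
lastDegree+classSize k p = begin
  lastDegree (suc k) p + classSize k p (p % suc k)
    ≡⟨ cong (_+ classSize k p (p % suc k))
            (∑-cong λ (i : Fin p) → cong ⟦_⟧ (apart-sym (suc k) (toℕ i) p)) ⟩
  ∑[ i < p ] ⟦ not (same i) ⟧ + ∑[ i < p ] ⟦ same i ⟧
    ≡⟨ sym (∑-distrib-+ (λ i → ⟦ not (same i) ⟧) (λ i → ⟦ same i ⟧)) ⟩
  ∑[ i < p ] (⟦ not (same i) ⟧ + ⟦ same i ⟧)
    ≡⟨ ∑-cong (λ i → ⟦not⟧+⟦⟧≡1 (same i)) ⟩
  ∑[ i < p ] 1
    ≡⟨ trans (∑-const p 1) (*-identityʳ p) ⟩
  p ∎
  where
  open ≡-Reasoning
  same : Fin p → Bool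
  same i = does (p % suc k ≟ toℕ i % suc k)

classSize-self : ∀ k c → classSize k c c ≡ 0
classSize-self k c = trans (∑-cong λ i → cong ⟦_⟧ (dec-false (c ≟ toℕ i % suc k) (c≢i%k+1 i)))
                           (sum-replicate-zero c)
  where
  c≢i%k+1 : ∀ (i : Fin c) → c ≢ toℕ i % suc k
  c≢i%k+1 i c≡i%k+1 = <-irrefl (sym c≡i%k+1) (≤-<-trans (m%n≤m (toℕ i) (suc k)) (Fin.toℕ<n i))

classSize-+ : ∀ k q {c} → c < suc k → classSize k (suc k + q) c ≡ suc (classSize k q c)
classSize-+ k q {c} c<k+1 = trans (∑-toℕ-+ (suc k) q (λ a → ⟦ does (c ≟ a % suc k) ⟧))
  (cong₂ _+_ (trans (∑-cong λ i → cong ⟦_⟧ (≟-residue c<k+1 i)) (∑-indicator-1 (fromℕ< c<k+1)))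
             (∑-cong λ (i : Fin q) → cong (λ r → ⟦ does (c ≟ r) ⟧) (%-remove-+ˡ (toℕ i) ∣-refl)))

classSize-residue : ∀ k {c} → c < suc k → ∀ m → classSize k (c + m * suc k) c ≡ m
classSize-residue k {c} c<k+1 zero = trans (cong (λ x → classSize k x c) (+-identityʳ c)) (classSize-self k c)
classSize-residue k {c} c<k+1 (suc m) = begin
  classSize k (c + (suc k + m * suc k)) c
    ≡⟨ cong (λ x → classSize k x c) (x+[y+z]≡y+[x+z] c (suc k) (m * suc k)) ⟩
  classSize k (suc k + (c + m * suc k)) c
    ≡⟨ classSize-+ k (c + m * suc k) c<k+1 ⟩
  suc (classSize k (c + m * suc k) c)
    ≡⟨ cong suc (classSize-residue k c<k+1 m) ⟩
  suc m ∎
  where open ≡-Reasoning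

lastDegree≡ : ∀ k p → lastDegree (suc k) p ≡ p ∸ p / suc k
lastDegree≡ k p = begin
  lastDegree (suc k) p
    ≡⟨ sym (m+n∸n≡m _ (classSize k p r)) ⟩
  lastDegree (suc k) p + classSize k p r ∸ classSize k p r
    ≡⟨ cong₂ _∸_ (lastDegree+classSize k p) classSize≡ ⟩
  p ∸ p / suc k ∎
  where
  open ≡-Reasoning
  r = p % suc k
  classSize≡ : classSize k p r ≡ p / suc k
  classSize≡ = trans (cong (λ x → classSize k x r) (m≡m%n+[m/n]*n p (suc k)))
                     (classSize-residue k (m%n<n p (suc k)) (p / suc k))

lastDegree-mono : ∀ K p → lastDegree K p ≤ lastDegree (suc K) p
lastDegree-mono zero p = ≤-trans (≤-reflexive (sum-replicate-zero p)) z≤n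
lastDegree-mono (suc k) p = subst₂ _≤_ (sym (lastDegree≡ k p)) (sym (lastDegree≡ (suc k) p))
  (∸-monoʳ-≤ p (/-monoʳ-≤ p (n≤1+n (suc k))))

turanDegreeSum-mono : ∀ K n → turanDegreeSum K n ≤ turanDegreeSum (suc K) n
turanDegreeSum-mono K zero = z≤n
turanDegreeSum-mono K (suc p) = subst₂ _≤_ (sym (turanDegreeSum-suc K p)) (sym (turanDegreeSum-suc (suc K) p))
  (+-mono-≤ (turanDegreeSum-mono K p) (+-mono-≤ (lastDegree-mono K p) (lastDegree-mono K p)))

turanEdges-double : ∀ n K → turanEdges n K + turanEdges n K ≡ turanDegreeSum K n
turanEdges-double n K = begin
  turanEdges n K + turanEdges n K
    ≡⟨ cong₂ _+_ unfold unfold ⟩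
  ∑[ i < n ] ∑[ j < n ] below i j + ∑[ i < n ] ∑[ j < n ] below i j
    ≡⟨ ∑∑-symmetrise below _ pair ⟩
  turanDegreeSum K n ∎
  where
  open ≡-Reasoning
  below : Fin n → Fin n → ℕ
  below i j = ⟦ does (toℕ i <? toℕ j) ∧ apart K (toℕ i) (toℕ j) ⟧
  unfold : turanEdges n K ≡ ∑[ i < n ] ∑[ j < n ] below i j
  unfold = trans (sum-map-allFin n _) (∑-cong λ i →
    trans (sum-map-allFin n (λ j → ⟦ does (toℕ i <? toℕ j) ∧ turanAdj K i j ⟧))
          (∑-cong λ j → cong (λ b → ⟦ does (toℕ i <? toℕ j) ∧ b ⟧) (turanAdj≡apart K i j)))
  pair : ∀ i j → below i j + below j i ≡ ⟦ apart K (toℕ i) (toℕ j) ⟧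
  pair i j with <-cmp (toℕ i) (toℕ j)
  ... | tri< i<j _ j≮i rewrite dec-true (toℕ i <? toℕ j) i<j | dec-false (toℕ j <? toℕ i) j≮i =
    +-identityʳ _
  ... | tri> i≮j _ j<i rewrite dec-false (toℕ i <? toℕ j) i≮j | dec-true (toℕ j <? toℕ i) j<i =
    cong ⟦_⟧ (apart-sym K (toℕ j) (toℕ i))
  ... | tri≈ i≮j i≡j j≮i
    rewrite dec-false (toℕ i <? toℕ j) i≮j | dec-false (toℕ j <? toℕ i) j≮i | i≡j =
    cong ⟦_⟧ (sym (apart-irrefl K (toℕ j)))

-- Turán's theorem

module Turán {n : ℕ} (G : Fin n → Fin n → Bool)
  (G-sym : ∀ x y → G x y ≡ G y x) (G-irrefl : ∀ x → G x x ≡ false) where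

  record Clique (j : ℕ) (P : Fin n → Bool) : Set where
    constructor clique
    field
      vertex : Fin j → Fin n
      inside : ∀ u → P (vertex u) ≡ true
      adjacent : ∀ u v → u ≢ v → G (vertex u) (vertex v) ≡ true

    vertex-injective : Injective _≡_ _≡_ vertex
    vertex-injective {u} {v} vertex-u≡vertex-v with u Fin.≟ v
    ... | yes u≡v = u≡v
    ... | no u≢v = contradiction
      (trans (sym (adjacent u v u≢v)) (trans (cong (λ x → G x (vertex v)) vertex-u≡vertex-v) (G-irrefl (vertex v))))
      λ ()

  open Clique

  nbhdIn : (Fin n → Bool) → Fin n → Fin n → Bool
  nbhdIn P a y = P y ∧ G a y

  cons : ∀ {j P} a → P a ≡ true → Clique j (nbhdIn P a) → Clique (suc j) P
  cons {j} {P} a Pa C = clique vertex′ inside′ adjacent′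
    where
    vertex′ : Fin (suc j) → Fin n
    vertex′ zero = a
    vertex′ (suc u) = vertex C u
    inside′ : ∀ u → P (vertex′ u) ≡ true
    inside′ zero = Pa
    inside′ (suc u) = proj₁ (∧≡true⇒ (inside C u))
    adjacent′ : ∀ u v → u ≢ v → G (vertex′ u) (vertex′ v) ≡ true
    adjacent′ zero zero 0≢0 = contradiction refl 0≢0
    adjacent′ zero (suc v) _ = proj₂ (∧≡true⇒ (inside C v))
    adjacent′ (suc u) zero _ = trans (G-sym (vertex C u) a) (proj₂ (∧≡true⇒ (inside C u)))
    adjacent′ (suc u) (suc v) u≢v = adjacent C u v (u≢v ∘ cong suc)

  uncons : ∀ {j P} → Clique (suc j) P → ∃[ a ] (P a ≡ true × Clique j (nbhdIn P a))
  uncons C = vertex C zero , inside C zero ,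
    clique (vertex C ∘ suc)
           (λ u → cong₂ _∧_ (inside C (suc u)) (adjacent C zero (suc u) λ ()))
           (λ u v u≢v → adjacent C (suc u) (suc v) (u≢v ∘ Fin.suc-injective))

  clique? : ∀ j P → Dec (Clique j P)
  clique? zero P = yes (clique (λ ()) (λ ()) (λ ()))
  clique? (suc j) P = map′ (λ { (a , Pa , C) → cons a Pa C }) uncons
    (Fin.any? λ a → (P a Bool.≟ true) ×-dec clique? j (nbhdIn P a))

  Clique-⊆ : ∀ {j B P} → (∀ x → B x ≡ true → P x ≡ true) → Clique j B → Clique j P
  Clique-⊆ B⊆P C = clique (vertex C) (λ u → B⊆P _ (inside C u)) (adjacent C)

  degreeIn : (Fin n → ℕ) → Fin n → ℕ
  degreeIn b x = ∑[ y < n ] (b y * ⟦ G x y ⟧)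

  edges : (Fin n → ℕ) → (Fin n → ℕ) → ℕ
  edges a b = ∑[ x < n ] (a x * degreeIn b x)

  edges-cong : ∀ {a a′ b b′} → (∀ x → a x ≡ a′ x) → (∀ y → b y ≡ b′ y) → edges a b ≡ edges a′ b′
  edges-cong a≡a′ b≡b′ =
    ∑-cong λ x → cong₂ _*_ (a≡a′ x) (∑-cong λ y → cong (_* ⟦ G x y ⟧) (b≡b′ y))

  edges-+ˡ : ∀ a a′ b → edges (λ x → a x + a′ x) b ≡ edges a b + edges a′ b
  edges-+ˡ a a′ b = trans (∑-cong λ x → *-distribʳ-+ (degreeIn b x) (a x) (a′ x))
                          (∑-distrib-+ (λ x → a x * degreeIn b x) (λ x → a′ x * degreeIn b x))

  edges-+ʳ : ∀ a b b′ → edges a (λ y → b y + b′ y) ≡ edges a b + edges a b′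
  edges-+ʳ a b b′ = trans (∑-cong λ x → trans (cong (a x *_) (degreeIn-+ x)) (*-distribˡ-+ (a x) _ _))
                          (∑-distrib-+ (λ x → a x * degreeIn b x) (λ x → a x * degreeIn b′ x))
    where
    degreeIn-+ : ∀ x → degreeIn (λ y → b y + b′ y) x ≡ degreeIn b x + degreeIn b′ x
    degreeIn-+ x = trans (∑-cong λ y → *-distribʳ-+ ⟦ G x y ⟧ (b y) (b′ y))
                         (∑-distrib-+ (λ y → b y * ⟦ G x y ⟧) (λ y → b′ y * ⟦ G x y ⟧))

  edges-comm : ∀ a b → edges a b ≡ edges b a
  edges-comm a b = begin
    ∑[ x < n ] (a x * ∑[ y < n ] (b y * ⟦ G x y ⟧))
      ≡⟨ ∑-cong (λ x → *-distribˡ-sum (a x) (λ y → b y * ⟦ G x y ⟧)) ⟩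
    ∑[ x < n ] ∑[ y < n ] (a x * (b y * ⟦ G x y ⟧))
      ≡⟨ ∑-comm (λ x y → a x * (b y * ⟦ G x y ⟧)) ⟩
    ∑[ y < n ] ∑[ x < n ] (a x * (b y * ⟦ G x y ⟧))
      ≡⟨ ∑∑-cong (λ y x → swap-ends y x) ⟩
    ∑[ y < n ] ∑[ x < n ] (b y * (a x * ⟦ G y x ⟧))
      ≡⟨ ∑-cong (λ y → sym (*-distribˡ-sum (b y) (λ x → a x * ⟦ G y x ⟧))) ⟩
    ∑[ y < n ] (b y * ∑[ x < n ] (a x * ⟦ G y x ⟧)) ∎
    where
    open ≡-Reasoning
    swap-ends : ∀ y x → a x * (b y * ⟦ G x y ⟧) ≡ b y * (a x * ⟦ G y x ⟧)
    swap-ends y x = trans (x*[y*z]≡y*[x*z] (a x) (b y) _) (cong (λ g → b y * (a x * ⟦ g ⟧)) (G-sym x y))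

  size : (Fin n → Bool) → ℕ
  size P = ∑[ x < n ] ⟦ P x ⟧

  degreeSum : (Fin n → Bool) → ℕ
  degreeSum P = edges (λ x → ⟦ P x ⟧) (λ x → ⟦ P x ⟧)

  module Peel {k} {P : Fin n → Bool} (C : Clique (suc k) P) (no-bigger : ¬ Clique (suc (suc k)) P) where

    -- Weighting the clique by multiplicity turns sums against it into sums over Fin (suc k).
    multiplicity : Fin n → ℕ
    multiplicity x = ∑[ u < suc k ] ⟦ vertex C u == x ⟧

    inClique? : ∀ x → Dec (∃[ u ] vertex C u ≡ x)
    inClique? x = Fin.any? (λ u → vertex C u Fin.≟ x)

    rest : Fin n → Bool
    rest x = P x ∧ not (does (inClique? x))

    multiplicity-vertex : ∀ u → multiplicity (vertex C u) ≡ 1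
    multiplicity-vertex u = trans
      (∑-cong λ v → cong ⟦_⟧ (does-⇔ equivalence (vertex C v Fin.≟ vertex C u) (u Fin.≟ v)))
      (∑-indicator-1 u)
      where
      equivalence : ∀ {v} → (vertex C v ≡ vertex C u) ⇔ (u ≡ v)
      equivalence = mk⇔ (sym ∘ vertex-injective C) (cong (vertex C) ∘ sym)

    multiplicity-outside : ∀ x → ¬ (∃[ u ] vertex C u ≡ x) → multiplicity x ≡ 0
    multiplicity-outside x ∉C = trans
      (∑-cong λ u → cong ⟦_⟧ (dec-false (vertex C u Fin.≟ x) (λ eq → ∉C (u , eq))))
      (sum-replicate-zero (suc k))

    split : ∀ x → ⟦ P x ⟧ ≡ multiplicity x + ⟦ rest x ⟧
    split x with inClique? x
    ... | yes (u , refl) = trans (cong ⟦_⟧ (inside C u)) (sym (cong₂ _+_ (multiplicity-vertex u)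
      (cong₂ (λ p b → ⟦ p ∧ not b ⟧) (inside C u) (dec-true (inClique? (vertex C u)) (u , refl)))))
    ... | no ∉C = sym (cong₂ _+_ (multiplicity-outside x ∉C)
      (trans (cong (λ b → ⟦ P x ∧ not b ⟧) (dec-false (inClique? x) ∉C))
             (cong ⟦_⟧ (Bool.∧-identityʳ (P x)))))

    ∑-multiplicity : ∑[ x < n ] multiplicity x ≡ suc k
    ∑-multiplicity = begin
      ∑[ x < n ] ∑[ u < suc k ] ⟦ vertex C u == x ⟧ ≡⟨ ∑-comm (λ x u → ⟦ vertex C u == x ⟧) ⟩
      ∑[ u < suc k ] ∑[ x < n ] ⟦ vertex C u == x ⟧ ≡⟨ ∑-cong (λ u → ∑-indicator-1 (vertex C u)) ⟩
      ∑[ u < suc k ] 1                              ≡⟨ trans (∑-const (suc k) 1) (*-identityʳ (suc k)) ⟩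
      suc k ∎
      where open ≡-Reasoning

    size-split : size P ≡ suc k + size rest
    size-split = trans (∑-cong split)
      (trans (∑-distrib-+ multiplicity (λ x → ⟦ rest x ⟧)) (cong (_+ size rest) ∑-multiplicity))

    rest-no-clique : ¬ Clique (suc (suc k)) rest
    rest-no-clique = no-bigger ∘ Clique-⊆ (λ x → proj₁ ∘ ∧≡true⇒)

    cliqueDegree : Fin n → ℕ
    cliqueDegree x = ∑[ u < suc k ] ⟦ G x (vertex C u) ⟧

    degreeIn-multiplicity : ∀ x → degreeIn multiplicity x ≡ cliqueDegree x
    degreeIn-multiplicity x = begin
      ∑[ y < n ] (∑[ u < suc k ] ⟦ vertex C u == y ⟧ * ⟦ G x y ⟧)
        ≡⟨ ∑-cong (λ y → *-distribʳ-sum ⟦ G x y ⟧ (λ u → ⟦ vertex C u == y ⟧)) ⟩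
      ∑[ y < n ] ∑[ u < suc k ] (⟦ vertex C u == y ⟧ * ⟦ G x y ⟧)
        ≡⟨ ∑-comm (λ y u → ⟦ vertex C u == y ⟧ * ⟦ G x y ⟧) ⟩
      ∑[ u < suc k ] ∑[ y < n ] (⟦ vertex C u == y ⟧ * ⟦ G x y ⟧)
        ≡⟨ ∑-cong (λ u → ∑-indicator (vertex C u) (λ y → ⟦ G x y ⟧)) ⟩
      cliqueDegree x ∎
      where open ≡-Reasoning

    -- A vertex of P adjacent to the whole clique would extend it.
    cliqueDegree-≤ : ∀ x → P x ≡ true → cliqueDegree x ≤ k
    cliqueDegree-≤ x Px with Fin.all? (λ u → G x (vertex C u) Bool.≟ true)
    ... | yes adjacent-to-all = contradiction
      (cons x Px (clique (vertex C) (λ u → cong₂ _∧_ (inside C u) (adjacent-to-all u)) (adjacent C))) no-bigger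
    ... | no ¬adjacent-to-all = ≤-trans (∑-mono-≤ pointwise) (≤-reflexive (∑-indicator-not u))
      where
      non-neighbour = Fin.¬∀⟶∃¬ (suc k) _ (λ u → G x (vertex C u) Bool.≟ true) ¬adjacent-to-all
      u = proj₁ non-neighbour
      pointwise : ∀ v → ⟦ G x (vertex C v) ⟧ ≤ ⟦ not (u == v) ⟧
      pointwise v with u Fin.≟ v
      ... | yes refl = ≤-trans (≤-reflexive (cong ⟦_⟧ (Bool.¬-not (proj₂ non-neighbour)))) z≤n
      ... | no _ = ⟦⟧≤1 (G x (vertex C v))

    edges-multiplicity-≤ : ∀ c → (∀ x → P x ≡ false → c x ≡ 0) →
      edges c multiplicity ≤ (∑[ x < n ] c x) * k
    edges-multiplicity-≤ c c⊆P = begin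
      edges c multiplicity               ≡⟨ ∑-cong (λ x → cong (c x *_) (degreeIn-multiplicity x)) ⟩
      ∑[ x < n ] (c x * cliqueDegree x)  ≤⟨ ∑-mono-≤ pointwise ⟩
      ∑[ x < n ] (c x * k)               ≡⟨ sym (*-distribʳ-sum k c) ⟩
      (∑[ x < n ] c x) * k               ∎
      where
      open ≤-Reasoning
      pointwise : ∀ x → c x * cliqueDegree x ≤ c x * k
      pointwise x with P x in Px
      ... | true = *-monoʳ-≤ (c x) (cliqueDegree-≤ x Px)
      ... | false rewrite c⊆P x Px = z≤n

    degreeSum-≤ : degreeSum P ≤ (suc k * k + size rest * k) + (size rest * k + degreeSum rest)
    degreeSum-≤ = begin
      degreeSum P
        ≡⟨ edges-cong split split ⟩
      edges (λ x → m x + r x) (λ x → m x + r x)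
        ≡⟨ trans (edges-+ˡ m r (λ x → m x + r x)) (cong₂ _+_ (edges-+ʳ m m r) (edges-+ʳ r m r)) ⟩
      (edges m m + edges m r) + (edges r m + edges r r)
        ≤⟨ +-mono-≤ (+-mono-≤ m-m (≤-trans (≤-reflexive (edges-comm m r)) r-m)) (+-mono-≤ r-m ≤-refl) ⟩
      (suc k * k + size rest * k) + (size rest * k + degreeSum rest) ∎
      where
      open ≤-Reasoning
      m r : Fin n → ℕ
      m = multiplicity
      r x = ⟦ rest x ⟧
      m-m : edges m m ≤ suc k * k
      m-m = subst (λ s → edges m m ≤ s * k) ∑-multiplicity
        (edges-multiplicity-≤ m λ x Px → m+n≡0⇒m≡0 (m x) (trans (sym (split x)) (cong ⟦_⟧ Px)))
      r-m : edges r m ≤ size rest * k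
      r-m = edges-multiplicity-≤ r λ x Px → cong (λ b → ⟦ b ∧ not (does (inClique? x)) ⟧) Px

  turán : ∀ K P → ¬ Clique (suc K) P → degreeSum P ≤ turanDegreeSum K (size P)
  turán zero P no-vertex = ≤-trans (≤-reflexive degreeSum≡0) z≤n
    where
    outside : ∀ x → P x ≡ false
    outside x = Bool.¬-not λ Px →
      no-vertex (clique (λ _ → x) (λ _ → Px) λ { zero zero 0≢0 → contradiction refl 0≢0 })
    degreeSum≡0 : degreeSum P ≡ 0
    degreeSum≡0 = trans (∑-cong λ x → cong (λ b → ⟦ b ⟧ * degreeIn (λ y → ⟦ P y ⟧) x) (outside x))
                        (sum-replicate-zero n)
  turán (suc k) P no-clique = peeling P (<-wellFounded (size P)) no-clique
    where
    peeling : ∀ P → Acc _<_ (size P) → ¬ Clique (suc (suc k)) P → degreeSum P ≤ turanDegreeSum (suc k) (size P)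
    peeling P (acc smaller) no-bigger with clique? (suc k) P
    ... | no no-K-clique = ≤-trans (turán k P no-K-clique) (turanDegreeSum-mono k (size P))
    ... | yes C = begin
      degreeSum P
        ≤⟨ degreeSum-≤ ⟩
      (suc k * k + q * k) + (q * k + degreeSum rest)
        ≤⟨ +-monoʳ-≤ (suc k * k + q * k)
                     (+-monoʳ-≤ (q * k) (peeling rest (smaller rest-smaller) rest-no-clique)) ⟩
      (suc k * k + q * k) + (q * k + turanDegreeSum (suc k) q)
        ≡⟨ sym (turanDegreeSum-peel k q) ⟩
      turanDegreeSum (suc k) (suc k + q)
        ≡⟨ cong (turanDegreeSum (suc k)) (sym size-split) ⟩
      turanDegreeSum (suc k) (size P) ∎
      where
      open ≤-Reasoning
      open Peel C no-bigger
      q = size rest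
      rest-smaller : size rest < size P
      rest-smaller = subst (size rest <_) (sym size-split) (s≤s (m≤n+m q k))

-- Oriented graphs and their underlying graphs

underlying : ∀ {n} → Digraph n → Fin n → Fin n → Bool
underlying D x y = D x y ∨ D y x

underlying-tournament : ∀ {n} {T : Digraph n} → IsTournament T → ∀ a b → underlying T a b ≡ not (a == b)
underlying-tournament ((no-loops , _) , complete) a b with a Fin.≟ b
... | yes refl = cong₂ _∨_ (Bool.¬-not (no-loops a)) (Bool.¬-not (no-loops a))
... | no a≢b = ⇒∨≡true (complete a b a≢b)

module _ {n} {D : Digraph n} (D-oriented : IsOriented D) where

  no-loop : ∀ x → D x x ≡ false
  no-loop x = Bool.¬-not (proj₁ D-oriented x)

  underlying-sym : ∀ x y → underlying D x y ≡ underlying D y x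
  underlying-sym x y = Bool.∨-comm (D x y) (D y x)

  underlying-irrefl : ∀ x → underlying D x x ≡ false
  underlying-irrefl x = cong₂ _∨_ (no-loop x) (no-loop x)

  arcCount-double : arcCount D + arcCount D ≡ ∑[ x < n ] ∑[ y < n ] ⟦ underlying D x y ⟧
  arcCount-double = trans (cong₂ _+_ (arcCount≡∑∑ D) (arcCount≡∑∑ D)) (∑∑-symmetrise _ _ pair)
    where
    pair : ∀ x y → ⟦ D x y ⟧ + ⟦ D y x ⟧ ≡ ⟦ D x y ∨ D y x ⟧
    pair x y with D x y in xy | D y x in yx
    ... | true  | true  = contradiction yx (proj₂ D-oriented x y xy)
    ... | true  | false = refl
    ... | false | true  = refl
    ... | false | false = refl

  open Turán (underlying D) underlying-sym underlying-irrefl using (Clique; degreeSum; size; turán)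
  open Clique

  clique-tournament : ∀ {j P} (C : Clique j P) → IsTournament (λ u v → D (vertex C u) (vertex C v))
  clique-tournament C =
    ((λ u → proj₁ D-oriented (vertex C u)) , (λ u v → proj₂ D-oriented (vertex C u) (vertex C v))) ,
    (λ u v u≢v → ∨≡true⇒ (adjacent C u v u≢v))

  free⇒no-clique : ∀ {m z} {F : Digraph m} → (∀ (T : Digraph z) → IsTournament T → Contains T F) →
    ¬ Contains D F → ¬ Clique z (λ _ → true)
  free⇒no-clique contains F-free C with contains _ (clique-tournament C)
  ... | f , f-injective , f-hom = F-free (vertex C ∘ f , f-injective ∘ vertex-injective C , f-hom)

  arcCount-≤ : ∀ {m} {F : Digraph m} K → (∀ (T : Digraph (suc K)) → IsTournament T → Contains T F) →
    ¬ Contains D F → arcCount D ≤ turanEdges n K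
  arcCount-≤ K contains F-free = halve-≤ (begin
    arcCount D + arcCount D                      ≡⟨ arcCount-double ⟩
    ∑[ x < n ] ∑[ y < n ] ⟦ underlying D x y ⟧   ≡⟨ degreeSum-everything ⟨
    degreeSum everything                         ≤⟨ turán K everything (free⇒no-clique contains F-free) ⟩
    turanDegreeSum K (size everything)           ≡⟨ cong (turanDegreeSum K) (trans (∑-const n 1) (*-identityʳ n)) ⟩
    turanDegreeSum K n                           ≡⟨ turanEdges-double n K ⟨
    turanEdges n K + turanEdges n K              ∎)
    where
    open ≤-Reasoning
    everything : Fin n → Bool
    everything _ = true
    degreeSum-everything : degreeSum everything ≡ ∑[ x < n ] ∑[ y < n ] ⟦ underlying D x y ⟧
    degreeSum-everything = ∑-cong λ (x : Fin n) →
      trans (*-identityˡ _) (∑-cong λ (y : Fin n) → *-identityˡ ⟦ underlying D x y ⟧)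

-- Blow-ups of tournaments

module BlowUp {k} (T : Digraph (suc k)) (T-tournament : IsTournament T) (n : ℕ) where

  class : Fin n → Fin (suc k)
  class x = fromℕ< (m%n<n (toℕ x) (suc k))

  toℕ-class : ∀ x → toℕ (class x) ≡ toℕ x % suc k
  toℕ-class x = Fin.toℕ-fromℕ< (m%n<n (toℕ x) (suc k))

  blowUp : Digraph n
  blowUp x y = T (class x) (class y)

  blowUp-oriented : IsOriented blowUp
  blowUp-oriented = (λ x → proj₁ T-oriented (class x)) , (λ x y → proj₂ T-oriented (class x) (class y))
    where T-oriented = proj₁ T-tournament

  blowUp-free : ∀ {m} {F : Digraph m} → ¬ HomExists F T → ¬ Contains blowUp F
  blowUp-free no-hom (f , _ , f-hom) = no-hom (class ∘ f , f-hom)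

  underlying-blowUp : ∀ x y → underlying blowUp x y ≡ turanAdj (suc k) x y
  underlying-blowUp x y = trans (underlying-tournament T-tournament (class x) (class y)) (cong not (sym same-class))
    where
    same-class : does (toℕ x % suc k ≟ toℕ y % suc k) ≡ class x == class y
    same-class = trans (cong₂ (λ a b → does (a ≟ b)) (sym (toℕ-class x)) (sym (toℕ-class y)))
                       (does-≟-toℕ (class x) (class y))

  arcCount-blowUp : arcCount blowUp ≡ turanEdges n (suc k)
  arcCount-blowUp = halve-≡ (begin
    arcCount blowUp + arcCount blowUp
      ≡⟨ arcCount-double blowUp-oriented ⟩
    ∑[ x < n ] ∑[ y < n ] ⟦ underlying blowUp x y ⟧
      ≡⟨ ∑∑-cong (λ x y → cong ⟦_⟧ (underlying-blowUp x y)) ⟩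
    turanDegreeSum (suc k) n
      ≡⟨ turanEdges-double n (suc k) ⟨
    turanEdges n (suc k) + turanEdges n (suc k) ∎)
    where open ≡-Reasoning

  extremal : ∀ {m} {F : Digraph m} → ¬ HomExists F T →
    ∃[ D ] (IsFreeOriented F D × arcCount D ≡ turanEdges n (suc k))
  extremal no-hom = blowUp , (blowUp-oriented , blowUp-free no-hom) , arcCount-blowUp

empty-tournament : ∀ {z} → z ≤ 1 → IsTournament {z} (λ _ _ → false)
empty-tournament z≤1 = ((λ _ ()) , (λ _ _ ())) ,
  λ u v u≢v → contradiction (Fin.toℕ-injective (trans (is-0 u) (sym (is-0 v)))) u≢v
  where
  is-0 : ∀ u → toℕ u ≡ 0
  is-0 u = n<1⇒n≡0 (≤-trans (Fin.toℕ<n u) z≤1)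

small-tournaments-avoid : ∀ {m z} (F : Digraph m) → z < m → z ≤ 1 →
  ¬ (∀ (T : Digraph z) → IsTournament T → Contains T F)
small-tournaments-avoid F z<m z≤1 contains with contains _ (empty-tournament z≤1)
... | f , f-injective , _ with Fin.pigeonhole z<m f
...   | i , j , i<j , fi≡fj = <⇒≢ i<j (cong toℕ (f-injective fi≡fj))

proposition2p1 : ∀ {m : ℕ} (F : Digraph m) (z : ℕ) →
    2 ≤ m →
    IsOriented F →
    IsCompressibility F z →
    (∀ (T : Digraph z) → IsTournament T → Contains T F) →
    ∀ (n : ℕ) → ExOri F n (turanEdges n (z ∸ 1))
proposition2p1 F zero 2≤m _ _ contains n =
  contradiction contains (small-tournaments-avoid F (≤-trans (s≤s z≤n) 2≤m) z≤n)
proposition2p1 F (suc zero) 2≤m _ _ contains n =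
  contradiction contains (small-tournaments-avoid F 2≤m ≤-refl)
proposition2p1 F (suc (suc k)) _ _ (_ , avoided-by-F) contains n
  with T , T-tournament , no-hom ← avoided-by-F (suc k) ≤-refl =
  BlowUp.extremal T T-tournament n no-hom ,
  λ D (D-oriented , D-free) → arcCount-≤ D-oriented (suc k) contains D-free
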